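{- Let $n\geq 1$ and $k\geq 1$ be integers. There is a bijection between $S(n,k)$ and $I(n,k)$.
   Context: Write $[k]=\{1,\dots,k\}$. $S(n,k)$ is the set of staircase arrays $(C_0,C_1,\dots,C_{n-1})$, where $C_0=\emptyset$ is the empty vector and, for $1\le i\le n-1$, $C_i$ is a vector of length $i$ with each entry in $[k]$; thus $|S(n,k)|=k^{1+2+\cdots+(n-1)}$. A $k$-ary tree is a rooted unlabeled tree in which each vertex has exactly $k$ subtrees in linear order (positions $1,\dots,k$), any of which may be empty; the $r$-th child of a vertex $u$ is the root of its $r$-th subtree (if nonempty). A staircase labeling of a $k$-ary tree $T$ with $n$ vertices is an assignment of labels to the vertices of $T$ such that the labels are vectors $C_0,C_1,\dots,C_{n-1}$, where $C_i$ is a vector of length $i$ with entries in $[k]$ (so each length $0,1,\dots,n-1$ occurs for exactly one vertex), satisfying: for any vertex $u$ with label $C_i$ and any proper descendant $v$ of $u$ with label $C_j$, we have $i<j$, and if the $r$-th child of $u$ lies on the path from $u$ to $v$, then the $(i+1)$-st entry of $C_j$ equals $r$. $I(n,k)$ denotes the set of $k$-ary trees with $n$ vertices together with a staircase labeling. -}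

module Defs where

open import Data.Nat using (ℕ; zero; suc; _<_)
open import Data.Fin using (Fin; fromℕ<)
open import Data.Vec using (Vec; []; _∷_; lookup)
open import Data.List using (List; []; _∷_; _++_; upTo)
open import Data.List.Relation.Unary.All using (All)
open import Data.List.Relation.Binary.Permutation.Propositional using (_↭_)
open import Data.Product using (Σ; Σ-syntax; _×_; _,_; proj₁)
open import Data.Unit using (⊤)
open import Relation.Binary.PropositionalEquality using (_≡_)
open import Relation.Binary.Bundles using (Setoid)
open import Relation.Binary.PropositionalEquality.Properties using () renaming (setoid to ≡-setoid)
import Relation.Binary.Construct.On as On

-- Convention: [k] = {1,...,k} is represented by Fin k (value r ↦ position r+1).

-- S(n,k): staircase arrays (C_0, C_1, ..., C_{n-1}), C_i ∈ [k]^i.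
-- `Staircase k n` is a snoc-list whose i-th entry (from the left,
-- 0-based) is a vector of length i.

data Staircase (k : ℕ) : ℕ → Set where
  []  : Staircase k zero
  _▷_ : {n : ℕ} → Staircase k n → Vec (Fin k) n → Staircase k (suc n)

S : ℕ → ℕ → Set
S n k = Staircase k n

-- k-ary trees whose vertices carry a label (a vector over [k] of some
-- length i).  `empty` is the empty (sub)tree; `node C ts` is a vertex
-- labelled C whose r-th subtree is `lookup ts r` (r : Fin k).

Label : ℕ → Set
Label k = Σ ℕ (λ i → Vec (Fin k) i)

data LTree (k : ℕ) : Set where
  empty : LTree k
  node  : {i : ℕ} → Vec (Fin k) i → Vec (LTree k) k → LTree k

mutual
  labels : {k : ℕ} → LTree k → List (Label k)
  labels empty         = []
  labels (node {i} C ts) = (i , C) ∷ labelsVec ts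

  labelsVec : {k m : ℕ} → Vec (LTree k) m → List (Label k)
  labelsVec []       = []
  labelsVec (t ∷ ts) = labels t ++ labelsVec ts

lengths : {k : ℕ} → LTree k → List ℕ
lengths t = Data.List.map proj₁ (labels t)
  where import Data.List

-- The condition imposed on a proper descendant v (label C_j) of a vertex u
-- with label C_i, when the r-th child of u is on the path from u to v:
-- i < j and the (i+1)-st entry of C_j (0-based index i) equals r.
DescCond : {k : ℕ} → ℕ → Fin k → Label k → Set
DescCond i r (j , C) = Σ (i < j) (λ i<j → lookup C (fromℕ< i<j) ≡ r)

mutual
  DescOK : {k : ℕ} → LTree k → Set
  DescOK empty = ⊤
  DescOK {k} (node {i} C ts) =
    ((r : Fin k) → All (DescCond i r) (labels (lookup ts r))) × DescOKVec ts

  DescOKVec : {k m : ℕ} → Vec (LTree k) m → Set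
  DescOKVec []       = ⊤
  DescOKVec (t ∷ ts) = DescOK t × DescOKVec ts

-- A labelled k-ary tree is a k-ary tree with n vertices together with a
-- staircase labeling iff the label lengths are exactly 0,1,...,n-1, each
-- occurring for exactly one vertex (so there are n vertices), and the
-- descendant condition holds.
IsStaircaseLabeled : {k : ℕ} → ℕ → LTree k → Set
IsStaircaseLabeled n t = (lengths t ↭ upTo n) × DescOK t

I : ℕ → ℕ → Set
I n k = Σ (LTree k) (IsStaircaseLabeled n)

-- Setoids: S(n,k) with propositional equality; I(n,k) with equality of
-- the underlying labelled trees (the proofs of the staircase property
-- are not data).

S-setoid : ℕ → ℕ → Setoid _ _
S-setoid n k = ≡-setoid (S n k)

I-setoid : ℕ → ℕ → Setoid _ _
I-setoid n k = On.setoid {B = I n k} (≡-setoid (LTree k)) proj₁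

-- The bijection S(n,k) → I(n,k) builds a tree by inserting the labels
-- C_0, C_1, …, C_{n-1} one after another.  To insert a vector C of length n
-- into a tree all of whose labels are shorter, start at the root and, at a
-- vertex whose label has length i, descend into the subtree indexed by the
-- entry of C at position i; the first empty subtree reached becomes a leaf
-- labelled C.  The path followed is exactly the one the descendant condition
-- prescribes, so insertion preserves staircase labelings and adds (n , C) to
-- the labels.  Conversely, in a staircase-labelled tree with label lengths
-- 0, …, n the vertex of length n is unique, and it is a leaf because its
-- descendants would need longer labels; deleting it and reinserting its label
-- gives back the tree.
module Submission where

open import Defs
open import Data.Nat using (ℕ; zero; suc; _≤_; _<_; _+_; s≤s⁻¹)
open import Data.Nat.Properties
  using (_≟_; _<?_; <-irrelevant; <-irrefl; <⇒≢; <⇒≱; ≤∧≢⇒<; ≟-diag; m<n⇒m<1+n; n<1+n;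
         suc-injective; ≡-irrelevant)
open import Data.Fin using (Fin; zero; suc; fromℕ<)
import Data.Fin.Properties as Fin
open import Data.Vec using (Vec; []; _∷_; lookup; replicate)
open import Data.Vec.Properties using (lookup-replicate)
open import Data.List using (List; []; _∷_; _++_; [_]; upTo; map; filter; length)
open import Data.List.Properties
  using (map-++; upTo-∷ʳ; length-++; filter-++; filter-accept; filter-reject; filter-none; filter-some)
open import Data.List.Relation.Unary.All using (All; []; _∷_) renaming (lookup to All-lookup; map to All-map)
open import Data.List.Relation.Unary.All.Properties using (++⁻ˡ; ++⁻ʳ; ++⁺; map⁻; all-upTo; ¬Any⇒All¬)
open import Data.List.Relation.Unary.Any using (here; there)
open import Data.List.Membership.Propositional using (_∈_)
open import Data.List.Membership.Propositional.Properties using (∈-++⁺ˡ; ∈-++⁺ʳ)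
open import Data.List.Relation.Binary.Permutation.Propositional
  using (_↭_; refl; prep; swap; trans; ↭-sym; ↭-reflexive; module PermutationReasoning)
open import Data.List.Relation.Binary.Permutation.Propositional.Properties
  using (All-resp-↭; ∈-resp-↭; map⁺; ++⁺ˡ; ++⁺ʳ; shift; drop-∷; ∷↭∷ʳ; ↭-empty-inv; ↭-length; filter-↭)
open import Data.Product using (Σ-syntax; _×_; _,_; proj₁)
open import Data.Product.Properties using (,-injectiveʳ-UIP)
open import Data.Unit using (tt)
open import Data.Empty using (⊥-elim)
open import Relation.Nullary using (yes; no)
open import Relation.Binary.PropositionalEquality
  using (_≡_; _≢_; refl; sym; cong; cong₂; module ≡-Reasoning) renaming (trans to ≡-trans)
open import Function.Bundles using (Bijection)

Below : ∀ {k} → ℕ → List (Label k) → Set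
Below n = All (λ l → proj₁ l < n)

Avoids : ∀ {k} → ℕ → List (Label k) → Set
Avoids n = All (λ l → proj₁ l ≢ n)

below⇒avoids : ∀ {k n} {ls : List (Label k)} → Below n ls → Avoids n ls
below⇒avoids = All-map <⇒≢

All-labels-lookup : ∀ {k m} {P : Label k → Set} (ts : Vec (LTree k) m) (r : Fin m) →
                    All P (labelsVec ts) → All P (labels (lookup ts r))
All-labels-lookup (t ∷ ts) zero    ps = ++⁻ˡ (labels t) ps
All-labels-lookup (t ∷ ts) (suc r) ps = All-labels-lookup ts r (++⁻ʳ (labels t) ps)

∈-labels-lookup : ∀ {k m} {x : Label k} (ts : Vec (LTree k) m) (r : Fin m) →
                  x ∈ labels (lookup ts r) → x ∈ labelsVec ts
∈-labels-lookup (t ∷ ts) zero    x∈ = ∈-++⁺ˡ x∈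
∈-labels-lookup (t ∷ ts) (suc r) x∈ = ∈-++⁺ʳ (labels t) (∈-labels-lookup ts r x∈)

labels-empty : ∀ {k} (t : LTree k) → labels t ≡ [] → t ≡ empty
labels-empty empty       _  = refl
labels-empty (node C ts) ()

labels-replicate-empty : ∀ {k m} (ts : Vec (LTree k) m) →
                         ((r : Fin m) → labels (lookup ts r) ≡ []) → ts ≡ replicate m empty
labels-replicate-empty []       _    = refl
labels-replicate-empty (t ∷ ts) none =
  cong₂ _∷_ (labels-empty t (none zero)) (labels-replicate-empty ts (λ r → none (suc r)))

leaf : ∀ {k n} → Vec (Fin k) n → LTree k
leaf {k} C = node C (replicate k empty)

labels-leaf : ∀ {k n} (C : Vec (Fin k) n) → labels (leaf C) ≡ [ (n , C) ]
labels-leaf {k} {n} C = cong ((n , C) ∷_) (labelsVec-replicate k)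
  where
  labelsVec-replicate : ∀ m → labelsVec {k} (replicate m empty) ≡ []
  labelsVec-replicate zero    = refl
  labelsVec-replicate (suc m) = labelsVec-replicate m

descOK-leaf : ∀ {k n} (C : Vec (Fin k) n) → DescOK (leaf C)
descOK-leaf {k} {n} C = noDescendants , descOKVec-replicate k
  where
  noDescendants : (r : Fin k) → All (DescCond n r) (labels (lookup (replicate k empty) r))
  noDescendants r rewrite lookup-replicate r (empty {k}) = []
  descOKVec-replicate : ∀ m → DescOKVec {k} (replicate m empty)
  descOKVec-replicate zero    = tt
  descOKVec-replicate (suc m) = tt , descOKVec-replicate m

mutual
  -- insert C t adds a leaf labelled C, descending at a vertex with label
  -- length i into the subtree indexed by the i-th entry of C.  (Vertices with
  -- labels at least as long as C do not occur in the intended use.)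
  insert : ∀ {k n} → Vec (Fin k) n → LTree k → LTree k
  insert C empty = leaf C
  insert {n = n} C (node {i} D ts) with i <? n
  ... | yes i<n = node D (insertAt C (lookup C (fromℕ< i<n)) ts)
  ... | no _    = node D ts

  insertAt : ∀ {k n m} → Vec (Fin k) n → Fin m → Vec (LTree k) m → Vec (LTree k) m
  insertAt C zero    (t ∷ ts) = insert C t ∷ ts
  insertAt C (suc r) (t ∷ ts) = t ∷ insertAt C r ts

insert-node : ∀ {k n i} (C : Vec (Fin k) n) (D : Vec (Fin k) i) (ts : Vec (LTree k) k) (i<n : i < n) →
              insert C (node D ts) ≡ node D (insertAt C (lookup C (fromℕ< i<n)) ts)
insert-node {n = n} {i} C D ts i<n with i <? n
... | yes i<n′ = cong (λ p → node D (insertAt C (lookup C (fromℕ< p)) ts)) (<-irrelevant i<n′ i<n)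
... | no i≮n   = ⊥-elim (i≮n i<n)

lookup-insertAt-same : ∀ {k n m} (C : Vec (Fin k) n) (r : Fin m) (ts : Vec (LTree k) m) →
                       lookup (insertAt C r ts) r ≡ insert C (lookup ts r)
lookup-insertAt-same C zero    (t ∷ ts) = refl
lookup-insertAt-same C (suc r) (t ∷ ts) = lookup-insertAt-same C r ts

lookup-insertAt-other : ∀ {k n m} (C : Vec (Fin k) n) (r s : Fin m) (ts : Vec (LTree k) m) →
                        s ≢ r → lookup (insertAt C r ts) s ≡ lookup ts s
lookup-insertAt-other C zero    zero    (t ∷ ts) s≢r = ⊥-elim (s≢r refl)
lookup-insertAt-other C zero    (suc s) (t ∷ ts) _   = refl
lookup-insertAt-other C (suc r) zero    (t ∷ ts) _   = refl
lookup-insertAt-other C (suc r) (suc s) (t ∷ ts) s≢r = lookup-insertAt-other C r s ts (λ e → s≢r (cong suc e))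

labels-insert : ∀ {k n} (C : Vec (Fin k) n) (t : LTree k) →
                Below n (labels t) → labels (insert C t) ↭ (n , C) ∷ labels t
labels-insertAt : ∀ {k n m} (C : Vec (Fin k) n) (r : Fin m) (ts : Vec (LTree k) m) →
                  Below n (labelsVec ts) → labelsVec (insertAt C r ts) ↭ (n , C) ∷ labelsVec ts
labels-insert C empty _ = ↭-reflexive (labels-leaf C)
labels-insert C (node {i} D ts) (i<n ∷ below) rewrite insert-node C D ts i<n =
  trans (prep (i , D) (labels-insertAt C (lookup C (fromℕ< i<n)) ts below)) (swap (i , D) _ refl)
labels-insertAt C zero (t ∷ ts) below =
  ++⁺ʳ (labelsVec ts) (labels-insert C t (++⁻ˡ (labels t) below))
labels-insertAt {n = n} C (suc r) (t ∷ ts) below =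
  trans (++⁺ˡ (labels t) (labels-insertAt C r ts (++⁻ʳ (labels t) below)))
        (shift (n , C) (labels t) (labelsVec ts))

below-insert : ∀ {k n} (C : Vec (Fin k) n) (t : LTree k) →
               Below n (labels t) → Below (suc n) (labels (insert C t))
below-insert {n = n} C t below =
  All-resp-↭ (↭-sym (labels-insert C t below)) (n<1+n n ∷ All-map m<n⇒m<1+n below)

-- Insertion preserves the descendant condition: the new leaf lies in the
-- subtree prescribed by C at every vertex on its path.
descOK-insert : ∀ {k n} (C : Vec (Fin k) n) (t : LTree k) →
                DescOK t → Below n (labels t) → DescOK (insert C t)
descOK-insertAt : ∀ {k n m} (C : Vec (Fin k) n) (r : Fin m) (ts : Vec (LTree k) m) →
                  DescOKVec ts → Below n (labelsVec ts) → DescOKVec (insertAt C r ts)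
descOK-insert C empty _ _ = descOK-leaf C
descOK-insert {k} C (node {i} D ts) (ok , oks) (i<n ∷ below) rewrite insert-node C D ts i<n =
  okAt , descOK-insertAt C r₀ ts oks below
  where
  r₀ : Fin k
  r₀ = lookup C (fromℕ< i<n)
  okAt : (r : Fin k) → All (DescCond i r) (labels (lookup (insertAt C r₀ ts) r))
  okAt r with r Fin.≟ r₀
  ... | yes refl rewrite lookup-insertAt-same C r₀ ts =
    All-resp-↭ (↭-sym (labels-insert C (lookup ts r₀) (All-labels-lookup ts r₀ below))) ((i<n , refl) ∷ ok r₀)
  ... | no r≢r₀ rewrite lookup-insertAt-other C r₀ r ts r≢r₀ = ok r
descOK-insertAt C zero    (t ∷ ts) (ok , oks) below = descOK-insert C t ok (++⁻ˡ (labels t) below) , oks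
descOK-insertAt C (suc r) (t ∷ ts) (ok , oks) below = ok , descOK-insertAt C r ts oks (++⁻ʳ (labels t) below)

mutual
  delete : ∀ {k} → ℕ → LTree k → LTree k
  delete n empty = empty
  delete n (node {i} C ts) with i ≟ n
  ... | yes _ = empty
  ... | no _  = node C (deleteAll n ts)

  deleteAll : ∀ {k m} → ℕ → Vec (LTree k) m → Vec (LTree k) m
  deleteAll n []       = []
  deleteAll n (t ∷ ts) = delete n t ∷ deleteAll n ts

lookup-deleteAll : ∀ {k m n} (ts : Vec (LTree k) m) (r : Fin m) →
                   lookup (deleteAll n ts) r ≡ delete n (lookup ts r)
lookup-deleteAll (t ∷ ts) zero    = refl
lookup-deleteAll (t ∷ ts) (suc r) = lookup-deleteAll ts r

delete-absent : ∀ {k n} (t : LTree k) → Avoids n (labels t) → delete n t ≡ t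
deleteAll-absent : ∀ {k m n} (ts : Vec (LTree k) m) → Avoids n (labelsVec ts) → deleteAll n ts ≡ ts
delete-absent empty _ = refl
delete-absent {n = n} (node {i} C ts) (i≢n ∷ avoids) with i ≟ n
... | yes i≡n = ⊥-elim (i≢n i≡n)
... | no _    = cong (node C) (deleteAll-absent ts avoids)
deleteAll-absent []       _      = refl
deleteAll-absent (t ∷ ts) avoids =
  cong₂ _∷_ (delete-absent t (++⁻ˡ (labels t) avoids)) (deleteAll-absent ts (++⁻ʳ (labels t) avoids))

delete-insert : ∀ {k n} (C : Vec (Fin k) n) (t : LTree k) → Below n (labels t) → delete n (insert C t) ≡ t
deleteAll-insertAt : ∀ {k n m} (C : Vec (Fin k) n) (r : Fin m) (ts : Vec (LTree k) m) →
                     Below n (labelsVec ts) → deleteAll n (insertAt C r ts) ≡ ts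
delete-insert {n = n} C empty _ rewrite ≟-diag {n} refl = refl
delete-insert {n = n} C (node {i} D ts) (i<n ∷ below) rewrite insert-node C D ts i<n with i ≟ n
... | yes i≡n = ⊥-elim (<-irrefl i≡n i<n)
... | no _    = cong (node D) (deleteAll-insertAt C (lookup C (fromℕ< i<n)) ts below)
deleteAll-insertAt C zero (t ∷ ts) below =
  cong₂ _∷_ (delete-insert C t (++⁻ˡ (labels t) below))
            (deleteAll-absent ts (below⇒avoids (++⁻ʳ (labels t) below)))
deleteAll-insertAt C (suc r) (t ∷ ts) below =
  cong₂ _∷_ (delete-absent t (below⇒avoids (++⁻ˡ (labels t) below)))
            (deleteAll-insertAt C r ts (++⁻ʳ (labels t) below))

-- Insertion of a label longer than all others is injective in both arguments:
-- the tree is recovered by deletion, the label as the unique label of length n.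
insert-injective : ∀ {k n} {C C′ : Vec (Fin k) n} {t t′ : LTree k} →
                   Below n (labels t) → Below n (labels t′) →
                   insert C t ≡ insert C′ t′ → t ≡ t′ × C ≡ C′
insert-injective {n = n} {C} {C′} {t} {t′} below below′ eq = trees , labels≡
  where
  trees : t ≡ t′
  trees = ≡-trans (sym (delete-insert C t below)) (≡-trans (cong (delete n) eq) (delete-insert C′ t′ below′))
  C∈ : (n , C) ∈ (n , C′) ∷ labels t′
  C∈ = ∈-resp-↭ (trans (↭-sym (labels-insert C t below))
                       (trans (↭-reflexive (cong labels eq)) (labels-insert C′ t′ below′))) (here refl)
  labels≡ : C ≡ C′
  labels≡ with C∈
  ... | here C≡C′ = ,-injectiveʳ-UIP ≡-irrelevant C≡C′
  ... | there C∈t′ = ⊥-elim (<-irrefl refl (All-lookup below′ C∈t′))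

All-delete : ∀ {k n} {P : Label k → Set} (t : LTree k) → All P (labels t) → All P (labels (delete n t))
All-deleteAll : ∀ {k m n} {P : Label k → Set} (ts : Vec (LTree k) m) →
                All P (labelsVec ts) → All P (labelsVec (deleteAll n ts))
All-delete empty _ = []
All-delete {n = n} (node {i} C ts) (p ∷ ps) with i ≟ n
... | yes _ = []
... | no _  = p ∷ All-deleteAll ts ps
All-deleteAll []       _  = []
All-deleteAll (t ∷ ts) ps = ++⁺ (All-delete t (++⁻ˡ (labels t) ps)) (All-deleteAll ts (++⁻ʳ (labels t) ps))

below-delete : ∀ {k n} (t : LTree k) → Below (suc n) (labels t) → Below n (labels (delete n t))
below-deleteAll : ∀ {k m n} (ts : Vec (LTree k) m) →
                  Below (suc n) (labelsVec ts) → Below n (labelsVec (deleteAll n ts))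
below-delete empty _ = []
below-delete {n = n} (node {i} C ts) (i<1+n ∷ below) with i ≟ n
... | yes _   = []
... | no i≢n  = ≤∧≢⇒< (s≤s⁻¹ i<1+n) i≢n ∷ below-deleteAll ts below
below-deleteAll []       _     = []
below-deleteAll (t ∷ ts) below =
  ++⁺ (below-delete t (++⁻ˡ (labels t) below)) (below-deleteAll ts (++⁻ʳ (labels t) below))

descOK-delete : ∀ {k n} (t : LTree k) → DescOK t → DescOK (delete n t)
descOK-deleteAll : ∀ {k m n} (ts : Vec (LTree k) m) → DescOKVec ts → DescOKVec (deleteAll n ts)
descOK-delete empty _ = tt
descOK-delete {n = n} (node {i} C ts) (ok , oks) with i ≟ n
... | yes _ = tt
... | no _  = okAt , descOK-deleteAll ts oks
  where
  okAt : ∀ r → All (DescCond i r) (labels (lookup (deleteAll n ts) r))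
  okAt r rewrite lookup-deleteAll {n = n} ts r = All-delete (lookup ts r) (ok r)
descOK-deleteAll []       _          = tt
descOK-deleteAll (t ∷ ts) (ok , oks) = descOK-delete t ok , descOK-deleteAll ts oks

count : ℕ → List ℕ → ℕ
count n xs = length (filter (_≟ n) xs)

count-++ : ∀ n xs ys → count n (xs ++ ys) ≡ count n xs + count n ys
count-++ n xs ys rewrite filter-++ (_≟ n) xs ys = length-++ (filter (_≟ n) xs)

count-↭ : ∀ n {xs ys} → xs ↭ ys → count n xs ≡ count n ys
count-↭ n xs↭ys = ↭-length (filter-↭ (_≟ n) xs↭ys)

count-zero : ∀ n xs → count n xs ≡ 0 → All (_≢ n) xs
count-zero n xs none = ¬Any⇒All¬ xs (λ occurs → <⇒≢ (filter-some (_≟ n) occurs) (sym none))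

count-skip : ∀ {n i} xs → i ≢ n → count n (i ∷ xs) ≡ count n xs
count-skip {n} xs i≢n = cong length (filter-reject (_≟ n) {xs = xs} i≢n)

upTo-suc : ∀ n → upTo (suc n) ↭ n ∷ upTo n
upTo-suc n = ↭-sym (trans (∷↭∷ʳ n (upTo n)) (↭-reflexive (upTo-∷ʳ n)))

count-upTo : ∀ n → count n (upTo (suc n)) ≡ 1
count-upTo n rewrite count-↭ n (upTo-suc n) | filter-accept (_≟ n) {xs = upTo n} refl
                   | filter-none (_≟ n) (All-map <⇒≢ (all-upTo n)) = refl

count-lengths-∷ : ∀ {k m} n (t : LTree k) (ts : Vec (LTree k) m) →
                  count n (map proj₁ (labelsVec (t ∷ ts))) ≡ count n (lengths t) + count n (map proj₁ (labelsVec ts))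
count-lengths-∷ n t ts rewrite map-++ proj₁ (labels t) (labelsVec ts) =
  count-++ n (lengths t) (map proj₁ (labelsVec ts))

avoids-count : ∀ {k} n (ls : List (Label k)) → count n (map proj₁ ls) ≡ 0 → Avoids n ls
avoids-count n ls none = map⁻ (count-zero n (map proj₁ ls) none)

childless : ∀ {k i} (ts : Vec (LTree k) k) → ((r : Fin k) → All (DescCond i r) (labels (lookup ts r))) →
            Below (suc i) (labelsVec ts) → ts ≡ replicate k empty
childless {k} {i = i} ts desc below =
  labels-replicate-empty ts (λ r → noLabels (labels (lookup ts r)) (desc r) (All-labels-lookup ts r below))
  where
  noLabels : ∀ {r : Fin k} ls → All (DescCond i r) ls → Below (suc i) ls → ls ≡ []
  noLabels []      _                _                = refl
  noLabels (_ ∷ _) ((i<j , _) ∷ _) (j<1+i ∷ _) = ⊥-elim (<⇒≱ i<j (s≤s⁻¹ j<1+i))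

extract : ∀ {k} n (t : LTree k) → DescOK t → Below (suc n) (labels t) → count n (lengths t) ≡ 1 →
          Σ[ C ∈ Vec (Fin k) n ] (n , C) ∈ labels t × insert C (delete n t) ≡ t
extractAt : ∀ {k m} n (ts : Vec (LTree k) m) → DescOKVec ts → Below (suc n) (labelsVec ts) →
            count n (map proj₁ (labelsVec ts)) ≡ 1 →
            Σ[ C ∈ Vec (Fin k) n ] Σ[ r ∈ Fin m ]
              (n , C) ∈ labels (lookup ts r) × insertAt C r (deleteAll n ts) ≡ ts
extract n empty _ _ ()
extract n (node {i} D ts) (ok , oks) (_ ∷ below) once with i ≟ n
... | yes refl = D , here refl , cong (node D) (sym (childless ts ok below))
... | no i≢n with extractAt n ts oks below (≡-trans (sym (count-skip (map proj₁ (labelsVec ts)) i≢n)) once)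
...   | C , r , C∈ , reinserted with All-lookup (ok r) C∈
...     | i<n , Cᵢ≡r = C , there (∈-labels-lookup ts r C∈) , (begin
  insert C (node D (deleteAll n ts))                            ≡⟨ insert-node C D (deleteAll n ts) i<n ⟩
  node D (insertAt C (lookup C (fromℕ< i<n)) (deleteAll n ts)) ≡⟨ cong (λ s → node D (insertAt C s (deleteAll n ts))) Cᵢ≡r ⟩
  node D (insertAt C r (deleteAll n ts))                        ≡⟨ cong (node D) reinserted ⟩
  node D ts                                                     ∎)
  where open ≡-Reasoning
extractAt n [] _ _ ()
extractAt n (t ∷ ts) (ok , oks) below once
  with count n (lengths t) in countT | ≡-trans (sym (count-lengths-∷ n t ts)) once
... | zero | onceInTs with extractAt n ts oks (++⁻ʳ (labels t) below) onceInTs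
...   | C , r , C∈ , reinserted =
  C , suc r , C∈ , cong₂ _∷_ (delete-absent t (avoids-count n (labels t) countT)) reinserted
extractAt n (t ∷ ts) (ok , oks) below once | suc zero | onceInT with extract n t ok (++⁻ˡ (labels t) below) countT
...   | C , C∈ , reinserted =
  C , zero , C∈ , cong₂ _∷_ reinserted (deleteAll-absent ts (avoids-count n (labelsVec ts) (suc-injective onceInT)))
extractAt n (t ∷ ts) (ok , oks) below once | suc (suc _) | ()

toTree : ∀ {n k} → S n k → LTree k
toTree []      = empty
toTree (s ▷ C) = insert C (toTree s)

below-toTree : ∀ {n k} (s : S n k) → Below n (labels (toTree s))
below-toTree []      = []
below-toTree (s ▷ C) = below-insert C (toTree s) (below-toTree s)

lengths-toTree : ∀ {n k} (s : S n k) → lengths (toTree s) ↭ upTo n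
lengths-toTree []              = refl
lengths-toTree {suc n} (s ▷ C) = begin
  lengths (insert C (toTree s)) ↭⟨ map⁺ proj₁ (labels-insert C (toTree s) (below-toTree s)) ⟩
  n ∷ lengths (toTree s)        ↭⟨ prep n (lengths-toTree s) ⟩
  n ∷ upTo n                    ↭⟨ upTo-suc n ⟨
  upTo (suc n)                  ∎
  where open PermutationReasoning

descOK-toTree : ∀ {n k} (s : S n k) → DescOK (toTree s)
descOK-toTree []      = tt
descOK-toTree (s ▷ C) = descOK-insert C (toTree s) (descOK-toTree s) (below-toTree s)

toTree-injective : ∀ {n k} (s s′ : S n k) → toTree s ≡ toTree s′ → s ≡ s′
toTree-injective []      []        _  = refl
toTree-injective (s ▷ C) (s′ ▷ C′) eq with insert-injective (below-toTree s) (below-toTree s′) eq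
... | trees , C≡C′ = cong₂ _▷_ (toTree-injective s s′ trees) C≡C′

below-upTo : ∀ {k n} (t : LTree k) → lengths t ↭ upTo n → Below n (labels t)
below-upTo {n = n} t lengths↭ = map⁻ (All-resp-↭ (↭-sym lengths↭) (all-upTo n))

lengths-delete : ∀ {k n} (C : Vec (Fin k) n) (t : LTree k) → lengths t ↭ upTo (suc n) →
                 insert C (delete n t) ≡ t → lengths (delete n t) ↭ upTo n
lengths-delete {n = n} C t lengths↭ reinserted = drop-∷ (begin
  n ∷ lengths (delete n t)        ↭⟨ map⁺ proj₁ (labels-insert C (delete n t) (below-delete t (below-upTo t lengths↭))) ⟨
  lengths (insert C (delete n t)) ≡⟨ cong lengths reinserted ⟩
  lengths t                       ↭⟨ lengths↭ ⟩
  upTo (suc n)                    ↭⟨ upTo-suc n ⟩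
  n ∷ upTo n                      ∎)
  where open PermutationReasoning

toTree-surjective : ∀ {k} n (t : LTree k) → IsStaircaseLabeled n t → Σ[ s ∈ S n k ] toTree s ≡ t
toTree-surjective zero empty _ = [] , refl
toTree-surjective zero (node C ts) (lengths↭ , _) with ↭-empty-inv lengths↭
... | ()
toTree-surjective (suc n) t (lengths↭ , ok) =
  let C , _ , reinserted = extract n t ok (below-upTo t lengths↭) (≡-trans (count-↭ n lengths↭) (count-upTo n))
      s , built          = toTree-surjective n (delete n t) (lengths-delete C t lengths↭ reinserted , descOK-delete t ok)
  in  s ▷ C , ≡-trans (cong (insert C) built) reinserted

-- The bijection holds for all n and k.
theorem2p2 : (n k : ℕ) → 1 ≤ n → 1 ≤ k → Bijection (S-setoid n k) (I-setoid n k)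
theorem2p2 n k _ _ = record
  { to        = λ s → toTree s , lengths-toTree s , descOK-toTree s
  ; cong      = λ { refl → refl }
  ; bijective = (λ {s} {s′} → toTree-injective s s′)
              , λ (t , labeled) → let s , built = toTree-surjective n t labeled in s , λ { refl → built }
  }
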